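{- Let $P$ and $Q$ be finite posets and let $f : P \to Q$ be a $\chi$-distinguished map. Then for every function $h : Q \to \mathbb{Z}$, \[ \int_{Q} h \, d\chi = \int_{P} (f^*h) \, d\chi , \] where $f^*h = h \circ f$.
   Context: An order-preserving map $f : P \to Q$ of finite posets is $\chi$-distinguished if $\chi(f^{ -1}(Q_{\ge x})) = 1$ for every $x \in Q$, where $Q_{\ge x} = \{y \in Q \mid y \ge x\}$ and $f^{ -1}(Q_{\ge x})$ carries the order induced from $P$. For a finite poset $P$, the zeta matrix is $\zeta(x,y) = 1$ if $x \le y$ and $0$ otherwise, and the Euler characteristic is $\chi(P) = \sum_{x,y}\zeta^{ -1}(x,y)$ ($\chi(\emptyset) = 0$). A filter is an upward closed subset; $\delta_S$ is the indicator function of $S$. Every $g : P \to \mathbb{Z}$ can be written as $g = \sum_i a_i\delta_{S_i}$ with $a_i\in\mathbb{Z}$ and $S_i$ filters of $P$, and the Euler calculus is $\int_P g\,d\chi = \sum_i a_i\chi(S_i)$, independent of the decomposition. -}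

module Defs where

open import Data.Nat using (ℕ; zero; suc)
open import Data.Fin using (Fin)
open import Data.Fin.Properties using (_≟_)
open import Data.Bool using (Bool; true; false; T; if_then_else_; _∧_)
open import Data.Integer using (ℤ; _+_; _*_; _-_; 0ℤ; 1ℤ)
open import Data.List using (List; []; _∷_; foldr; map; allFin)
open import Data.Product using (_×_; _,_)
open import Relation.Nullary.Decidable using (⌊_⌋)
open import Relation.Binary.Core using (Rel)
open import Relation.Binary.Definitions using (Decidable)
open import Relation.Binary.Structures using (IsPartialOrder)
open import Relation.Binary.PropositionalEquality using (_≡_)
open import Level using (0ℓ)

record FinPoset : Set₁ where
  field
    size      : ℕ
    _≤_       : Rel (Fin size) 0ℓ
    _≤?_      : Decidable _≤_
    isPartialOrder : IsPartialOrder _≡_ _≤_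

  Elt : Set
  Elt = Fin size

open FinPoset public

Σℤ : (n : ℕ) → (Fin n → ℤ) → ℤ
Σℤ n g = foldr _+_ 0ℤ (map g (allFin n))

Mat : ℕ → Set
Mat n = Fin n → Fin n → ℤ

_·_ : {n : ℕ} → Mat n → Mat n → Mat n
_·_ {n} A B i j = Σℤ n (λ k → A i k * B k j)

_⊕_ : {n : ℕ} → Mat n → Mat n → Mat n
(A ⊕ B) i j = A i j + B i j

_⊖_ : {n : ℕ} → Mat n → Mat n → Mat n
(A ⊖ B) i j = A i j - B i j

bℤ : Bool → ℤ
bℤ true  = 1ℤ
bℤ false = 0ℤ

Subset : FinPoset → Set
Subset P = Elt P → Bool

-- Zeta matrix of the subposet S (induced order), extended by 0 outside S×S.
zetaS : (P : FinPoset) → Subset P → Mat (size P)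
zetaS P S x y = bℤ (S x ∧ S y ∧ ⌊ (P ._≤?_) x y ⌋)

idS : (P : FinPoset) → Subset P → Mat (size P)
idS P S x y = bℤ (S x ∧ ⌊ x ≟ y ⌋)

pow : {n : ℕ} → Mat n → ℕ → Mat n
pow {n} A zero i j = bℤ ⌊ i ≟ j ⌋
pow {n} A (suc k) = A · pow A k

geom : {n : ℕ} → Mat n → ℕ → Mat n
geom A zero = pow A zero
geom A (suc m) = geom A m ⊕ pow A (suc m)

-- Inverse of the zeta matrix of the subposet S (on the S×S block):
-- ζ_S = I_S - N_S with N_S = I_S - ζ_S nilpotent (N_S^{size} = 0),
-- hence ζ_S^{-1} = Σ_{k=0}^{size} N_S^k (restricted to S×S).
zetaInvS : (P : FinPoset) → Subset P → Mat (size P)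
zetaInvS P S x y = bℤ (S x ∧ S y) * geom (idS P S ⊖ zetaS P S) (size P) x y

χ : (P : FinPoset) → Subset P → ℤ
χ P S = Σℤ (size P) (λ x → Σℤ (size P) (λ y → zetaInvS P S x y))

χ-total : FinPoset → ℤ
χ-total P = χ P (λ _ → true)

IsFilter : (P : FinPoset) → Subset P → Set
IsFilter P S = ∀ x y → (P ._≤_) x y → T (S x) → T (S y)

upSet : (Q : FinPoset) → Elt Q → Subset Q
upSet Q x y = ⌊ (Q ._≤?_) x y ⌋

preimage : (P Q : FinPoset) → (Elt P → Elt Q) → Subset Q → Subset P
preimage P Q f T' p = T' (f p)

OrderPreserving : (P Q : FinPoset) → (Elt P → Elt Q) → Set
OrderPreserving P Q f = ∀ a b → (P ._≤_) a b → (Q ._≤_) (f a) (f b)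

χ-Distinguished : (P Q : FinPoset) → (Elt P → Elt Q) → Set
χ-Distinguished P Q f = ∀ x → χ P (preimage P Q f (upSet Q x)) ≡ 1ℤ

-- A filter decomposition g = Σ_i a_i δ_{S_i}: a list of (a_i , S_i) with S_i filters.
FilterComb : FinPoset → Set
FilterComb P = List (ℤ × Subset P)

AllFilters : (P : FinPoset) → FilterComb P → Set
AllFilters P [] = Data.Unit.⊤ where import Data.Unit
AllFilters P ((a , S) ∷ ds) = IsFilter P S × AllFilters P ds

evalComb : (P : FinPoset) → FilterComb P → Elt P → ℤ
evalComb P [] x = 0ℤ
evalComb P ((a , S) ∷ ds) x = a * bℤ (S x) + evalComb P ds x

IsDecomposition : (P : FinPoset) → (Elt P → ℤ) → FilterComb P → Set
IsDecomposition P g ds = AllFilters P ds × (∀ x → g x ≡ evalComb P ds x)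

∫comb : (P : FinPoset) → FilterComb P → ℤ
∫comb P [] = 0ℤ
∫comb P ((a , S) ∷ ds) = a * χ P S + ∫comb P ds

-- Let μ = ζ⁻¹ be the Möbius matrix of P and weight x = Σ_y μ(x,y). Since ν = 1 − ζ is
-- strictly upper triangular (its nonzero entries ν(x,z) have x < z, and then ↑z ⊊ ↑x),
-- it is nilpotent, so the truncated geometric series defining zetaInvS really inverts ζ.
-- For a filter S, ζ_S⁻¹ is the restriction of μ to S × S and μ vanishes on S × (P ∖ S),
-- since ν never leads out of S; hence χ(S) = Σ_{x∈S} weight x, and ∫ g dχ = Σ_x g(x) weight(x)
-- for every filter decomposition of g. The weights are the unique solution of
-- Σ_{y ≥ x} w(y) = 1 for all x, as ζ is injective. The push-forward of weight_P along f
-- satisfies Σ_{y ≥ x} (f_* weight_P)(y) = χ(f⁻¹(Q_{≥x})) = 1, so f_* weight_P = weight_Q,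
-- and both integrals equal Σ_q h(q) weight_Q(q).

{-# OPTIONS --safe #-}
module Submission where

open import Defs
open import Data.Integer using (ℤ)
open import Relation.Binary.PropositionalEquality using (_≡_)
open import Function using (_∘_; flip)

import Data.Integer.Properties as ℤ
open import Algebra.Properties.Semiring.Sum ℤ.+-*-semiring
  using (sum; sum-cong-≗; sum-replicate-zero; ∑-distrib-+; ∑-comm; *-distribˡ-sum)
open import Data.Bool using (Bool; true; false; T)
open import Data.Empty using (⊥-elim)
open import Data.Fin using (Fin; zero; suc)
open import Data.Fin.Properties using (_≟_)
open import Data.Fin.Subset as Subset using (_∈_; _⊂_; ∣_∣)
open import Data.Fin.Subset.Induction using (⊂-wellFounded)
open import Data.Fin.Subset.Properties using (p⊂q⇒∣p∣<∣q∣; ∣p∣≤n; x∈p⇒∣p-x∣<∣p∣)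
open import Data.Integer using (_+_; _*_; _-_; -_; 0ℤ; 1ℤ; -1ℤ)
open import Data.Integer.Solver using (module +-*-Solver)
open import Data.List using ([]; _∷_; foldr)
open import Data.List.Properties using (map-tabulate)
import Data.Nat as ℕ
import Data.Nat.Properties as ℕ
open import Data.Product using (_×_; _,_)
open import Data.Sum using (_⊎_; inj₁; inj₂)
open import Data.Unit using (tt)
open import Data.Vec using (tabulate)
open import Data.Vec.Properties using (lookup∘tabulate; lookup⇒[]=; []=⇒lookup)
open import Induction.WellFounded using (WellFounded; Acc; acc; module Subrelation)
import Relation.Binary.Construct.On as On
open import Relation.Binary.PropositionalEquality
  using (_≢_; refl; sym; trans; cong; cong₂; subst; module ≡-Reasoning)
open import Relation.Binary.Structures using (IsPartialOrder)
open import Relation.Nullary using (¬_; Dec; yes; no)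
open import Relation.Nullary.Decidable
  using (⌊_⌋; isYes≗does; ⌊⌋-map′; dec-true; dec-false; toWitness; fromWitness)

open +-*-Solver using (solve; _:+_; _:*_; _:-_; _:=_)
open ≡-Reasoning

Σℤ≡sum : ∀ n (f : Fin n → ℤ) → Σℤ n f ≡ sum f
Σℤ≡sum ℕ.zero    f = refl
Σℤ≡sum (ℕ.suc n) f = begin
  f zero + foldr _+_ 0ℤ (Data.List.map f (Data.List.tabulate suc))
    ≡⟨ cong (λ l → f zero + foldr _+_ 0ℤ l)
            (trans (map-tabulate suc f) (sym (map-tabulate (λ i → i) (f ∘ suc)))) ⟩
  f zero + Σℤ n (f ∘ suc)
    ≡⟨ cong (f zero +_) (Σℤ≡sum n (f ∘ suc)) ⟩
  sum f ∎

Σℤ-cong : ∀ n {f g : Fin n → ℤ} → (∀ i → f i ≡ g i) → Σℤ n f ≡ Σℤ n g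
Σℤ-cong n {f} {g} f≗g = begin
  Σℤ n f ≡⟨ Σℤ≡sum n f ⟩
  sum f  ≡⟨ sum-cong-≗ f≗g ⟩
  sum g  ≡⟨ Σℤ≡sum n g ⟨
  Σℤ n g ∎

Σℤ-zero : ∀ n {f : Fin n → ℤ} → (∀ i → f i ≡ 0ℤ) → Σℤ n f ≡ 0ℤ
Σℤ-zero n f≗0 = trans (Σℤ-cong n f≗0) (trans (Σℤ≡sum n _) (sum-replicate-zero n))

Σℤ-distrib-+ : ∀ n (f g : Fin n → ℤ) → Σℤ n (λ i → f i + g i) ≡ Σℤ n f + Σℤ n g
Σℤ-distrib-+ n f g = begin
  Σℤ n (λ i → f i + g i) ≡⟨ Σℤ≡sum n _ ⟩
  sum (λ i → f i + g i)  ≡⟨ ∑-distrib-+ f g ⟩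
  sum f + sum g          ≡⟨ cong₂ _+_ (Σℤ≡sum n f) (Σℤ≡sum n g) ⟨
  Σℤ n f + Σℤ n g        ∎

*-distribˡ-Σℤ : ∀ n c (f : Fin n → ℤ) → c * Σℤ n f ≡ Σℤ n (λ i → c * f i)
*-distribˡ-Σℤ n c f = begin
  c * Σℤ n f             ≡⟨ cong (c *_) (Σℤ≡sum n f) ⟩
  c * sum f              ≡⟨ *-distribˡ-sum c f ⟩
  sum (λ i → c * f i)    ≡⟨ Σℤ≡sum n _ ⟨
  Σℤ n (λ i → c * f i)   ∎

Σℤ-neg : ∀ n (f : Fin n → ℤ) → Σℤ n (λ i → - f i) ≡ - Σℤ n f
Σℤ-neg n f = begin
  Σℤ n (λ i → - f i)        ≡⟨ Σℤ-cong n (λ i → ℤ.-1*i≡-i (f i)) ⟨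
  Σℤ n (λ i → -1ℤ * f i)    ≡⟨ *-distribˡ-Σℤ n -1ℤ f ⟨
  -1ℤ * Σℤ n f              ≡⟨ ℤ.-1*i≡-i (Σℤ n f) ⟩
  - Σℤ n f                  ∎

Σℤ-distrib-- : ∀ n (f g : Fin n → ℤ) → Σℤ n (λ i → f i - g i) ≡ Σℤ n f - Σℤ n g
Σℤ-distrib-- n f g = trans (Σℤ-distrib-+ n f (λ i → - g i)) (cong (Σℤ n f +_) (Σℤ-neg n g))

Σℤ-comm : ∀ m n (f : Fin m → Fin n → ℤ) →
          Σℤ m (λ i → Σℤ n (f i)) ≡ Σℤ n (λ j → Σℤ m (λ i → f i j))
Σℤ-comm m n f = begin
  Σℤ m (λ i → Σℤ n (f i))              ≡⟨ Σℤ-cong m (λ i → Σℤ≡sum n (f i)) ⟩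
  Σℤ m (λ i → sum (f i))               ≡⟨ Σℤ≡sum m _ ⟩
  sum (λ i → sum (f i))                ≡⟨ ∑-comm f ⟩
  sum (λ j → sum (λ i → f i j))        ≡⟨ Σℤ≡sum n _ ⟨
  Σℤ n (λ j → sum (λ i → f i j))       ≡⟨ Σℤ-cong n (λ j → Σℤ≡sum m (λ i → f i j)) ⟨
  Σℤ n (λ j → Σℤ m (λ i → f i j))      ∎

⌊⌋-yes : ∀ {A : Set} (a? : Dec A) → A → ⌊ a? ⌋ ≡ true
⌊⌋-yes a? a = trans (isYes≗does a?) (dec-true a? a)

⌊⌋-no : ∀ {A : Set} (a? : Dec A) → ¬ A → ⌊ a? ⌋ ≡ false
⌊⌋-no a? ¬a = trans (isYes≗does a?) (dec-false a? ¬a)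

δ : ∀ {n} → Mat n
δ x y = bℤ ⌊ x ≟ y ⌋

δ-≢ : ∀ {n} {x y : Fin n} → x ≢ y → δ x y ≡ 0ℤ
δ-≢ {x = x} {y} x≢y = cong bℤ (⌊⌋-no (x ≟ y) x≢y)

δ-suc : ∀ {n} (x y : Fin n) → δ (suc x) (suc y) ≡ δ x y
δ-suc x y = cong bℤ (⌊⌋-map′ _ _ (x ≟ y))

sum-δ : ∀ {n} (x : Fin n) (g : Fin n → ℤ) → sum (λ q → δ x q * g q) ≡ g x
sum-δ {ℕ.suc n} zero g = begin
  1ℤ * g zero + sum (λ q → 0ℤ * g (suc q))
    ≡⟨ cong₂ _+_ (ℤ.*-identityˡ (g zero)) (sum-cong-≗ (λ q → ℤ.*-zeroˡ (g (suc q)))) ⟩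
  g zero + sum (λ (_ : Fin n) → 0ℤ)
    ≡⟨ cong (g zero +_) (sum-replicate-zero n) ⟩
  g zero + 0ℤ
    ≡⟨ ℤ.+-identityʳ (g zero) ⟩
  g zero ∎
sum-δ {ℕ.suc n} (suc x) g = begin
  0ℤ * g zero + sum (λ q → δ (suc x) (suc q) * g (suc q))
    ≡⟨ cong₂ _+_ (ℤ.*-zeroˡ (g zero)) (sum-cong-≗ (λ q → cong (_* g (suc q)) (δ-suc x q))) ⟩
  0ℤ + sum (λ q → δ x q * g (suc q))
    ≡⟨ ℤ.+-identityˡ _ ⟩
  sum (λ q → δ x q * g (suc q))
    ≡⟨ sum-δ x (g ∘ suc) ⟩
  g (suc x) ∎

Σℤ-δ : ∀ n (x : Fin n) (g : Fin n → ℤ) → Σℤ n (λ q → δ x q * g q) ≡ g x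
Σℤ-δ n x g = trans (Σℤ≡sum n _) (sum-δ x g)

·-distribˡ-⊕ : ∀ {n} (A B C : Mat n) x y → (A · (B ⊕ C)) x y ≡ (A · B) x y + (A · C) x y
·-distribˡ-⊕ {n} A B C x y = trans
  (Σℤ-cong n (λ z → ℤ.*-distribˡ-+ (A x z) (B z y) (C z y)))
  (Σℤ-distrib-+ n (λ z → A x z * B z y) (λ z → A x z * C z y))

geom-telescope : ∀ {n} (A : Mat n) m x y →
                 geom A m x y - (A · geom A m) x y ≡ δ x y - pow A (ℕ.suc m) x y
geom-telescope A ℕ.zero    x y = refl
geom-telescope A (ℕ.suc m) x y = begin
  (G + Aᵐ⁺¹) - (A · geom A (ℕ.suc m)) x y
    ≡⟨ cong (λ t → (G + Aᵐ⁺¹) - t) (·-distribˡ-⊕ A (geom A m) (pow A (ℕ.suc m)) x y) ⟩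
  (G + Aᵐ⁺¹) - (AG + Aᵐ⁺²)
    ≡⟨ solve 4 (λ g a ag b → (g :+ a) :- (ag :+ b) := (g :- ag) :+ (a :- b)) refl G Aᵐ⁺¹ AG Aᵐ⁺² ⟩
  (G - AG) + (Aᵐ⁺¹ - Aᵐ⁺²)
    ≡⟨ cong (_+ (Aᵐ⁺¹ - Aᵐ⁺²)) (geom-telescope A m x y) ⟩
  (δ x y - Aᵐ⁺¹) + (Aᵐ⁺¹ - Aᵐ⁺²)
    ≡⟨ solve 3 (λ d a b → (d :- a) :+ (a :- b) := d :- b) refl (δ x y) Aᵐ⁺¹ Aᵐ⁺² ⟩
  δ x y - Aᵐ⁺² ∎
  where
  G    = geom A m x y
  AG   = (A · geom A m) x y
  Aᵐ⁺¹ = pow A (ℕ.suc m) x y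
  Aᵐ⁺² = pow A (ℕ.suc (ℕ.suc m)) x y

≢-across : ∀ {n} (S : Fin n → Bool) {x z} → S x ≡ true → S z ≡ false → x ≢ z
≢-across S Sx Sz refl with () ← trans (sym Sx) Sz

Invariant : ∀ {n} → Mat n → (Fin n → Bool) → Set
Invariant {n} A S = ∀ {x z : Fin n} → S x ≡ true → S z ≡ false → A x z ≡ 0ℤ

module _ {n} {A : Mat n} {S : Fin n → Bool} (A-inv : Invariant A S) where

  pow-invariant : ∀ k {x y} → S x ≡ true → S y ≡ false → pow A k x y ≡ 0ℤ
  pow-invariant ℕ.zero    Sx Sy = δ-≢ (≢-across S Sx Sy)
  pow-invariant (ℕ.suc k) {x} {y} Sx Sy = Σℤ-zero n term
    where
    term : ∀ z → A x z * pow A k z y ≡ 0ℤ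
    term z with S z in Sz
    ... | true  = trans (cong (A x z *_) (pow-invariant k Sz Sy)) (ℤ.*-zeroʳ (A x z))
    ... | false = trans (cong (_* pow A k z y) (A-inv Sx Sz)) (ℤ.*-zeroˡ (pow A k z y))

  geom-invariant : ∀ m {x y} → S x ≡ true → S y ≡ false → geom A m x y ≡ 0ℤ
  geom-invariant ℕ.zero    Sx Sy = pow-invariant ℕ.zero Sx Sy
  geom-invariant (ℕ.suc m) Sx Sy = cong₂ _+_ (geom-invariant m Sx Sy) (pow-invariant (ℕ.suc m) Sx Sy)

  module _ {B : Mat n} (B≡A : ∀ {x} z → S x ≡ true → B x z ≡ A x z) where

    pow-agree : ∀ k {x} y → S x ≡ true → pow B k x y ≡ pow A k x y
    pow-agree ℕ.zero    y Sx = refl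
    pow-agree (ℕ.suc k) {x} y Sx = Σℤ-cong n term
      where
      term : ∀ z → B x z * pow B k z y ≡ A x z * pow A k z y
      term z with S z in Sz
      ... | true  = cong₂ _*_ (B≡A z Sx) (pow-agree k y Sz)
      ... | false = begin
        B x z * pow B k z y ≡⟨ cong (_* pow B k z y) (trans (B≡A z Sx) (A-inv Sx Sz)) ⟩
        0ℤ * pow B k z y    ≡⟨ ℤ.*-zeroˡ (pow B k z y) ⟩
        0ℤ                  ≡⟨ ℤ.*-zeroˡ (pow A k z y) ⟨
        0ℤ * pow A k z y    ≡⟨ cong (_* pow A k z y) (A-inv Sx Sz) ⟨
        A x z * pow A k z y ∎

    geom-agree : ∀ m {x} y → S x ≡ true → geom B m x y ≡ geom A m x y
    geom-agree ℕ.zero    y Sx = refl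
    geom-agree (ℕ.suc m) y Sx = cong₂ _+_ (geom-agree m y Sx) (pow-agree (ℕ.suc m) y Sx)

module _ (P : FinPoset) where

  private
    n = size P

  open FinPoset P using () renaming (_≤_ to _≼_; _≤?_ to _≼?_)
  open IsPartialOrder (isPartialOrder P) using (antisym) renaming (refl to ≼-refl; trans to ≼-trans)

  _≺_ : Elt P → Elt P → Set
  x ≺ z = x ≼ z × x ≢ z

  ↑_ : Elt P → Subset.Subset n
  ↑ x = tabulate (λ z → ⌊ x ≼? z ⌋)

  ∈↑⁺ : ∀ {x z} → x ≼ z → z ∈ ↑ x
  ∈↑⁺ {x} {z} x≼z = lookup⇒[]= z (↑ x) (trans (lookup∘tabulate _ z) (⌊⌋-yes (x ≼? z) x≼z))

  ∈↑⁻ : ∀ {x z} → z ∈ ↑ x → x ≼ z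
  ∈↑⁻ {x} {z} z∈↑x
    with x ≼? z | trans (sym (lookup∘tabulate (λ z → ⌊ x ≼? z ⌋) z)) ([]=⇒lookup z∈↑x)
  ... | yes x≼z | _ = x≼z
  ... | no _    | ()

  ↑-⊂ : ∀ {x z} → x ≺ z → ↑ z ⊂ ↑ x
  ↑-⊂ {x} {z} (x≼z , x≢z) =
    (λ y∈↑z → ∈↑⁺ (≼-trans x≼z (∈↑⁻ y∈↑z))) ,
    x , ∈↑⁺ ≼-refl , λ x∈↑z → x≢z (antisym x≼z (∈↑⁻ x∈↑z))

  ∣↑∣-positive : ∀ x → 0 ℕ.< ∣ ↑ x ∣
  ∣↑∣-positive x = ℕ.≤-<-trans ℕ.z≤n (x∈p⇒∣p-x∣<∣p∣ (∈↑⁺ ≼-refl))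

  >-wellFounded : WellFounded (flip _≺_)
  >-wellFounded = Subrelation.wellFounded ↑-⊂ (On.wellFounded ↑_ ⊂-wellFounded)

  ζ : Mat n
  ζ x y = bℤ ⌊ x ≼? y ⌋

  ν : Mat n
  ν x y = δ x y - ζ x y

  ν-on : Subset P → Mat n
  ν-on S = idS P S ⊖ zetaS P S

  μ : Mat n
  μ = geom ν n

  weight : Elt P → ℤ
  weight x = Σℤ n (μ x)

  upSum : (Elt P → ℤ) → Elt P → ℤ
  upSum g x = Σℤ n (λ q → ζ x q * g q)

  ζ-≰ : ∀ {x z} → ¬ x ≼ z → ζ x z ≡ 0ℤ
  ζ-≰ {x} {z} x⋠z = cong bℤ (⌊⌋-no (x ≼? z) x⋠z)

  ν-triangular : ∀ x z → ν x z ≡ 0ℤ ⊎ x ≺ z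
  ν-triangular x z with x ≟ z | x ≼? z
  ... | yes refl | yes _    = inj₁ refl
  ... | yes refl | no x⋠x   = ⊥-elim (x⋠x ≼-refl)
  ... | no x≢z   | yes x≼z  = inj₂ (x≼z , x≢z)
  ... | no _     | no _     = inj₁ refl

  ν-annihilates : ∀ {x} (F : Elt P → ℤ) → (∀ {z} → x ≺ z → F z ≡ 0ℤ) →
                  Σℤ n (λ z → ν x z * F z) ≡ 0ℤ
  ν-annihilates {x} F F-vanishes = Σℤ-zero n term
    where
    term : ∀ z → ν x z * F z ≡ 0ℤ
    term z with ν-triangular x z
    ... | inj₁ νxz≡0 = trans (cong (_* F z) νxz≡0) (ℤ.*-zeroˡ (F z))
    ... | inj₂ x≺z   = trans (cong (ν x z *_) (F-vanishes x≺z)) (ℤ.*-zeroʳ (ν x z))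

  pow-ν-vanishes : ∀ k {x} y → ∣ ↑ x ∣ ℕ.≤ k → pow ν k x y ≡ 0ℤ
  pow-ν-vanishes ℕ.zero    {x} y ∣↑x∣≤0 = ⊥-elim (ℕ.<⇒≱ (∣↑∣-positive x) ∣↑x∣≤0)
  pow-ν-vanishes (ℕ.suc k) {x} y ∣↑x∣≤k+1 = ν-annihilates (λ z → pow ν k z y) λ x≺z →
    pow-ν-vanishes k y (ℕ.≤-pred (ℕ.<-≤-trans (p⊂q⇒∣p∣<∣q∣ (↑-⊂ x≺z)) ∣↑x∣≤k+1))

  ν-nilpotent : ∀ x y → pow ν (ℕ.suc n) x y ≡ 0ℤ
  ν-nilpotent x y = pow-ν-vanishes (ℕ.suc n) y (ℕ.m≤n⇒m≤1+n (∣p∣≤n (↑ x)))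

  upSum≡id-ν : ∀ g x → upSum g x ≡ g x - Σℤ n (λ q → ν x q * g q)
  upSum≡id-ν g x = begin
    Σℤ n (λ q → ζ x q * g q)
      ≡⟨ Σℤ-cong n (λ q → solve 3 (λ d z a → z :* a := d :* a :- (d :- z) :* a) refl (δ x q) (ζ x q) (g q)) ⟩
    Σℤ n (λ q → δ x q * g q - ν x q * g q)
      ≡⟨ Σℤ-distrib-- n _ _ ⟩
    Σℤ n (λ q → δ x q * g q) - Σℤ n (λ q → ν x q * g q)
      ≡⟨ cong (_- Σℤ n (λ q → ν x q * g q)) (Σℤ-δ n x g) ⟩
    g x - Σℤ n (λ q → ν x q * g q) ∎

  ζ·μ≡δ : ∀ x y → (ζ · μ) x y ≡ δ x y
  ζ·μ≡δ x y = begin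
    (ζ · μ) x y                     ≡⟨ upSum≡id-ν (λ q → μ q y) x ⟩
    μ x y - (ν · μ) x y             ≡⟨ geom-telescope ν n x y ⟩
    δ x y - pow ν (ℕ.suc n) x y     ≡⟨ cong (λ t → δ x y - t) (ν-nilpotent x y) ⟩
    δ x y - 0ℤ                      ≡⟨ ℤ.+-identityʳ (δ x y) ⟩
    δ x y                           ∎

  upSum-weight : ∀ x → upSum weight x ≡ 1ℤ
  upSum-weight x = begin
    Σℤ n (λ q → ζ x q * Σℤ n (μ q))
      ≡⟨ Σℤ-cong n (λ q → *-distribˡ-Σℤ n (ζ x q) (μ q)) ⟩
    Σℤ n (λ q → Σℤ n (λ y → ζ x q * μ q y))
      ≡⟨ Σℤ-comm n n _ ⟩
    Σℤ n (λ y → (ζ · μ) x y)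
      ≡⟨ Σℤ-cong n (λ y → trans (ζ·μ≡δ x y) (sym (ℤ.*-identityʳ (δ x y)))) ⟩
    Σℤ n (λ y → δ x y * 1ℤ)
      ≡⟨ Σℤ-δ n x (λ _ → 1ℤ) ⟩
    1ℤ ∎

  upSum-kernel : ∀ (D : Elt P → ℤ) → (∀ x → upSum D x ≡ 0ℤ) → ∀ x → D x ≡ 0ℤ
  upSum-kernel D upSumD≡0 x = vanish (>-wellFounded x)
    where
    vanish : ∀ {x} → Acc (flip _≺_) x → D x ≡ 0ℤ
    vanish {x} (acc above) = begin
      D x                             ≡⟨ ℤ.+-identityʳ (D x) ⟨
      D x - 0ℤ                        ≡⟨ cong (λ t → D x - t) ν·D≡0 ⟨
      D x - Σℤ n (λ z → ν x z * D z)  ≡⟨ upSum≡id-ν D x ⟨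
      upSum D x                       ≡⟨ upSumD≡0 x ⟩
      0ℤ                              ∎
      where
      ν·D≡0 : Σℤ n (λ z → ν x z * D z) ≡ 0ℤ
      ν·D≡0 = ν-annihilates D (λ x≺z → vanish (above x≺z))

  upSum-injective : ∀ (A B : Elt P → ℤ) → (∀ x → upSum A x ≡ upSum B x) → ∀ x → A x ≡ B x
  upSum-injective A B upSumA≡upSumB x =
    ℤ.i-j≡0⇒i≡j (A x) (B x) (upSum-kernel (λ q → A q - B q) upSum-A-B≡0 x)
    where
    upSum-A-B≡0 : ∀ x → upSum (λ q → A q - B q) x ≡ 0ℤ
    upSum-A-B≡0 x = begin
      Σℤ n (λ q → ζ x q * (A q - B q))
        ≡⟨ Σℤ-cong n (λ q → solve 3 (λ z a b → z :* (a :- b) := z :* a :- z :* b) refl (ζ x q) (A q) (B q)) ⟩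
      Σℤ n (λ q → ζ x q * A q - ζ x q * B q)
        ≡⟨ Σℤ-distrib-- n _ _ ⟩
      upSum A x - upSum B x
        ≡⟨ cong (_- upSum B x) (upSumA≡upSumB x) ⟩
      upSum B x - upSum B x
        ≡⟨ ℤ.+-inverseʳ (upSum B x) ⟩
      0ℤ ∎

  ζ-outside : ∀ {S x z} → IsFilter P S → S x ≡ true → S z ≡ false → ζ x z ≡ 0ℤ
  ζ-outside {S} {x} {z} S-filter Sx Sz = ζ-≰ λ x≼z →
    subst T Sz (S-filter x z x≼z (subst T (sym Sx) tt))

  ν-invariant : ∀ {S} → IsFilter P S → Invariant ν S
  ν-invariant {S} S-filter Sx Sz = cong₂ _-_ (δ-≢ (≢-across S Sx Sz)) (ζ-outside S-filter Sx Sz)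

  ν-restrict : ∀ {S} → IsFilter P S → ∀ {x} z → S x ≡ true → ν-on S x z ≡ ν x z
  ν-restrict {S} S-filter {x} z Sx rewrite Sx with S z in Sz
  ... | true  = refl
  ... | false = cong (λ t → δ x z - t) (sym (ζ-outside S-filter Sx Sz))

  zetaInvS-filter : ∀ {S} → IsFilter P S → ∀ x y → zetaInvS P S x y ≡ bℤ (S x) * μ x y
  zetaInvS-filter {S} S-filter x y with S x in Sx | S y in Sy
  ... | true  | true  = cong (1ℤ *_) (geom-agree (ν-invariant S-filter) (ν-restrict S-filter) n y Sx)
  ... | true  | false = begin
    0ℤ * νₛ*    ≡⟨ ℤ.*-zeroˡ νₛ* ⟩
    0ℤ          ≡⟨ geom-invariant (ν-invariant S-filter) n Sx Sy ⟨
    μ x y       ≡⟨ ℤ.*-identityˡ (μ x y) ⟨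
    1ℤ * μ x y  ∎
    where νₛ* = geom (ν-on S) n x y
  ... | false | _     = trans (ℤ.*-zeroˡ (geom (ν-on S) n x y)) (sym (ℤ.*-zeroˡ (μ x y)))

  χ-filter : ∀ {S} → IsFilter P S → χ P S ≡ Σℤ n (λ x → bℤ (S x) * weight x)
  χ-filter {S} S-filter = Σℤ-cong n λ x → trans
    (Σℤ-cong n (zetaInvS-filter S-filter x))
    (sym (*-distribˡ-Σℤ n (bℤ (S x)) (μ x)))

  ∫comb-weight : ∀ {g ds} → IsDecomposition P g ds → ∫comb P ds ≡ Σℤ n (λ x → g x * weight x)
  ∫comb-weight {g} {ds} (ds-filters , g≗ds) =
    trans (∫comb≡Σ ds ds-filters) (Σℤ-cong n (λ x → cong (_* weight x) (sym (g≗ds x))))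
    where
    ∫comb≡Σ : ∀ ds → AllFilters P ds → ∫comb P ds ≡ Σℤ n (λ x → evalComb P ds x * weight x)
    ∫comb≡Σ []             _                   = sym (Σℤ-zero n (λ x → ℤ.*-zeroˡ (weight x)))
    ∫comb≡Σ ((a , S) ∷ ds) (S-filter , filters) = begin
      a * χ P S + ∫comb P ds
        ≡⟨ cong₂ _+_ (cong (a *_) (χ-filter S-filter)) (∫comb≡Σ ds filters) ⟩
      a * Σℤ n (λ x → bℤ (S x) * weight x) + Σℤ n (λ x → evalComb P ds x * weight x)
        ≡⟨ cong (_+ Σℤ n (λ x → evalComb P ds x * weight x)) (*-distribˡ-Σℤ n a _) ⟩
      Σℤ n (λ x → a * (bℤ (S x) * weight x)) + Σℤ n (λ x → evalComb P ds x * weight x)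
        ≡⟨ Σℤ-distrib-+ n _ _ ⟨
      Σℤ n (λ x → a * (bℤ (S x) * weight x) + evalComb P ds x * weight x)
        ≡⟨ Σℤ-cong n (λ x → solve 4 (λ a s e w → a :* (s :* w) :+ e :* w := (a :* s :+ e) :* w) refl
                               a (bℤ (S x)) (evalComb P ds x) (weight x)) ⟩
      Σℤ n (λ x → evalComb P ((a , S) ∷ ds) x * weight x) ∎

upSet-filter : ∀ Q x → IsFilter Q (upSet Q x)
upSet-filter Q x a b a≤b x≤a =
  fromWitness (IsPartialOrder.trans (isPartialOrder Q) (toWitness x≤a) a≤b)

preimage-filter : ∀ P Q {f T} → OrderPreserving P Q f → IsFilter Q T → IsFilter P (preimage P Q f T)
preimage-filter P Q {f} f-mono T-filter a b a≤b = T-filter (f a) (f b) (f-mono a b a≤b)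

push : ∀ P Q → (Elt P → Elt Q) → (Elt P → ℤ) → Elt Q → ℤ
push P Q f g q = Σℤ (size P) (λ p → δ (f p) q * g p)

Σℤ-push : ∀ P Q f (h : Elt Q → ℤ) g →
          Σℤ (size Q) (λ q → h q * push P Q f g q) ≡ Σℤ (size P) (λ p → h (f p) * g p)
Σℤ-push P Q f h g = begin
  Σℤ m (λ q → h q * Σℤ n (λ p → δ (f p) q * g p))
    ≡⟨ Σℤ-cong m (λ q → *-distribˡ-Σℤ n (h q) _) ⟩
  Σℤ m (λ q → Σℤ n (λ p → h q * (δ (f p) q * g p)))
    ≡⟨ Σℤ-comm m n _ ⟩
  Σℤ n (λ p → Σℤ m (λ q → h q * (δ (f p) q * g p)))
    ≡⟨ Σℤ-cong n (λ p → Σℤ-cong m (λ q →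
         solve 3 (λ a d b → a :* (d :* b) := d :* (a :* b)) refl (h q) (δ (f p) q) (g p))) ⟩
  Σℤ n (λ p → Σℤ m (λ q → δ (f p) q * (h q * g p)))
    ≡⟨ Σℤ-cong n (λ p → Σℤ-δ m (f p) (λ q → h q * g p)) ⟩
  Σℤ n (λ p → h (f p) * g p) ∎
  where
  m = size Q
  n = size P

weight-push : ∀ P Q f → OrderPreserving P Q f → χ-Distinguished P Q f →
              ∀ q → push P Q f (weight P) q ≡ weight Q q
weight-push P Q f f-mono f-χ = upSum-injective Q _ _ λ x → begin
  upSum Q (push P Q f (weight P)) x
    ≡⟨ Σℤ-push P Q f (ζ Q x) (weight P) ⟩
  Σℤ (size P) (λ p → ζ Q x (f p) * weight P p)
    ≡⟨ χ-filter P (preimage-filter P Q f-mono (upSet-filter Q x)) ⟨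
  χ P (preimage P Q f (upSet Q x))
    ≡⟨ f-χ x ⟩
  1ℤ
    ≡⟨ upSum-weight Q x ⟨
  upSum Q (weight Q) x ∎

theorem4p10 : (P Q : FinPoset) (f : Elt P → Elt Q)
    → OrderPreserving P Q f
    → χ-Distinguished P Q f
    → (h : Elt Q → ℤ)
    → (dQ : FilterComb Q) → IsDecomposition Q h dQ
    → (dP : FilterComb P) → IsDecomposition P (h ∘ f) dP
    → ∫comb Q dQ ≡ ∫comb P dP
theorem4p10 P Q f f-mono f-χ h dQ dQ-decomposes dP dP-decomposes = begin
  ∫comb Q dQ
    ≡⟨ ∫comb-weight Q dQ-decomposes ⟩
  Σℤ (size Q) (λ q → h q * weight Q q)
    ≡⟨ Σℤ-cong (size Q) (λ q → cong (h q *_) (weight-push P Q f f-mono f-χ q)) ⟨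
  Σℤ (size Q) (λ q → h q * push P Q f (weight P) q)
    ≡⟨ Σℤ-push P Q f h (weight P) ⟩
  Σℤ (size P) (λ p → h (f p) * weight P p)
    ≡⟨ ∫comb-weight P dP-decomposes ⟨
  ∫comb P dP ∎
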